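{- Let $\lambda=(\lambda_1,\dots,\lambda_r)$ be a non-empty \textsc{RIT} position and suppose that $\bar\lambda$ is obtained from $\lambda$ by an \textsc{RIT}-move on an odd-numbered row of $\lambda$. Then $\mathrm{core}(\bar\lambda)=\mathrm{core}(\lambda)$ and $\mathrm{rem}(\lambda)\to_{\textsc{Nim}}\mathrm{rem}(\bar\lambda)$ is a \textsc{Nim}-move. Conversely, for any \textsc{Nim}-move $\mathrm{rem}(\lambda)\to_{\textsc{Nim}} p$ there exists an \textsc{RIT}-move $\lambda\to\bar\lambda$ on an odd-numbered row of $\lambda$ such that $\mathrm{core}(\bar\lambda)=\mathrm{core}(\lambda)$ and $\mathrm{rem}(\bar\lambda)=p$.
   Context: An \textsc{RIT} (Row Impartial Terminus) position is a partition $\lambda=(\lambda_1,\dots,\lambda_r)$, written as a nonincreasing tuple of nonnegative integers (a move keeps the length $r$ of the tuple, zero entries being allowed; the empty partition/all-zero tuple is the unique terminal position). For $k\in[1,\lambda_1]$, there is a move from $\lambda$ to $\bar\lambda$ where $\bar\lambda_i=k-1$ for $i$ the largest index with $\lambda_i\ge k$, and $\bar\lambda_j=\lambda_j$ for $j\ne i$; this is called a move on the $i$th row. Informally, a move shortens one row of the Young diagram so that the result is still a Young diagram. Define $\mathrm{core}(\lambda)=(\lambda_2,\lambda_2,\lambda_4,\lambda_4,\dots,\lambda_{2\lfloor r/2\rfloor},\lambda_{2\lfloor r/2\rfloor})$ and $\mathrm{rem}(\lambda)$ to be the $\lceil r/2\rceil$-tuple $(\lambda_1-\lambda_2,\lambda_3-\lambda_4,\dots,\lambda_{2\lceil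 r/2\rceil-1}-\lambda_{2\lceil r/2\rceil})$, where $\lambda_j=0$ for $j>r$. \textsc{Nim} is played on tuples of nonnegative integers: a move decreases exactly one coordinate by a positive amount (keeping it nonnegative). -}

module Defs where

open import Data.Nat using (ℕ; zero; suc; _∸_; _≤_; _<_)
open import Data.Fin using (Fin; toℕ)
open import Data.Vec using (Vec; []; _∷_; lookup; _[_]≔_)
open import Data.Product using (Σ; _×_)
open import Relation.Binary.PropositionalEquality using (_≡_; _≢_)

-- A tuple (λ₁,…,λᵣ) is an RIT position (partition) iff it is nonincreasing.
-- Rows are 1-based in the paper; Fin index i corresponds to row toℕ i + 1.
IsPartition : {r : ℕ} → Vec ℕ r → Set
IsPartition {r} lam = (i j : Fin r) → toℕ i ≤ toℕ j → lookup lam j ≤ lookup lam i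

-- λ₁, with the convention λⱼ = 0 for j > r.
first : {r : ℕ} → Vec ℕ r → ℕ
first []      = 0
first (x ∷ _) = x

-- RIT move on the row with (0-based) Fin index i, from lam to lam':
-- some k ∈ [1, λ₁] such that i is the largest index with λᵢ ≥ k,
-- and lam' is lam with entry i replaced by k - 1.
RITMoveOnRow : {r : ℕ} → Vec ℕ r → Fin r → Vec ℕ r → Set
RITMoveOnRow {r} lam i lam' =
  Σ ℕ λ k → (1 ≤ k) × (k ≤ first lam) × (k ≤ lookup lam i)
          × ((j : Fin r) → toℕ i < toℕ j → lookup lam j < k)
          × (lam' ≡ lam [ i ]≔ (k ∸ 1))

-- Odd-numbered row (1-based): 0-based index even.
OddRow : {r : ℕ} → Fin r → Set
OddRow i = Data.Nat._%_ (toℕ i) 2 ≡ 0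

coreLen : ℕ → ℕ
coreLen zero          = zero
coreLen (suc zero)    = zero
coreLen (suc (suc n)) = suc (suc (coreLen n))

remLen : ℕ → ℕ
remLen zero          = zero
remLen (suc zero)    = suc zero
remLen (suc (suc n)) = suc (remLen n)

core : {r : ℕ} → Vec ℕ r → Vec ℕ (coreLen r)
core []            = []
core (_ ∷ [])      = []
core (_ ∷ b ∷ t)   = b ∷ b ∷ core t

-- rem(λ) = (λ₁-λ₂, λ₃-λ₄, …), with λⱼ = 0 for j > r
rem : {r : ℕ} → Vec ℕ r → Vec ℕ (remLen r)
rem []            = []
rem (a ∷ [])      = a ∷ []
rem (a ∷ b ∷ t)   = (a ∸ b) ∷ rem t

NimMove : {n : ℕ} → Vec ℕ n → Vec ℕ n → Set
NimMove {n} p q =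
  Σ (Fin n) λ i → (lookup q i < lookup p i)
                × ((j : Fin n) → j ≢ i → lookup q j ≡ lookup p j)

-- Both core and rem are computed from the pairs of rows (λ₂ₘ₊₁, λ₂ₘ₊₂). A move on
-- row 2m+1 cuts that row to some x with λ₂ₘ₊₂ ≤ x < λ₂ₘ₊₁: this leaves core alone
-- and lowers the m-th entry of rem from λ₂ₘ₊₁ − λ₂ₘ₊₂ to x − λ₂ₘ₊₂. Conversely, on
-- a partition, lowering that entry to q is achieved by the cut x = q + λ₂ₘ₊₂.
module Submission where

open import Defs
open import Data.Nat using (ℕ; zero; suc; _+_; _∸_; _≤_; _<_; z≤n; s≤s)
open import Data.Nat.Properties using (≤-trans; ≤-pred; ∸-monoˡ-<; m≤o∸n⇒m+n≤o; m+n∸n≡m; m≤n+m)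
open import Data.Fin using (Fin; toℕ; zero; suc)
open import Data.Fin.Properties using (suc-injective)
open import Data.Vec using (Vec; []; _∷_; lookup; _[_]≔_; replicate; tabulate)
open import Data.Vec.Properties using (tabulate∘lookup; tabulate-cong)
open import Data.Product using (Σ; _×_; _,_)
open import Data.Sum using (_⊎_; inj₁; inj₂)
open import Function using (_∘_)
open import Relation.Nullary using (contradiction)
open import Relation.Binary.PropositionalEquality
  using (_≡_; _≢_; _≗_; refl; sym; cong; cong₂; module ≡-Reasoning)

lookup-extensionality : ∀ {a} {A : Set a} {n} {u v : Vec A n} → lookup u ≗ lookup v → u ≡ v
lookup-extensionality {u = u} {v} u≗v = begin
  u                   ≡⟨ tabulate∘lookup u ⟨
  tabulate (lookup u) ≡⟨ tabulate-cong u≗v ⟩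
  tabulate (lookup v) ≡⟨ tabulate∘lookup v ⟩
  v                   ∎
  where open ≡-Reasoning

isPartition-tail : ∀ {r} {a} {lam : Vec ℕ r} → IsPartition (a ∷ lam) → IsPartition lam
isPartition-tail part i j i≤j = part (suc i) (suc j) (s≤s i≤j)

isPartition-lookup≤first : ∀ {r} (lam : Vec ℕ r) → IsPartition lam → (i : Fin r) → lookup lam i ≤ first lam
isPartition-lookup≤first (_ ∷ _) part i = part zero i z≤n

-- An RIT move with parameter k cuts row i down to x = k − 1.
ShortensRow : ∀ {r} → Vec ℕ r → Fin r → ℕ → Set
ShortensRow {r} lam i x = x < lookup lam i × ((j : Fin r) → toℕ i < toℕ j → lookup lam j ≤ x)

shortensRow-tail : ∀ {r} {a x} {lam : Vec ℕ r} {i} → ShortensRow (a ∷ lam) (suc i) x → ShortensRow lam i x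
shortensRow-tail (x<λᵢ , later) = x<λᵢ , λ j i<j → later (suc j) (s≤s i<j)

shortensRow-∷ : ∀ {r} {a x} {lam : Vec ℕ r} {i} → ShortensRow lam i x → ShortensRow (a ∷ lam) (suc i) x
shortensRow-∷ (x<λᵢ , later) = x<λᵢ , λ { zero () ; (suc j) (s≤s i<j) → later j i<j }

ritMove⇒shortensRow : ∀ {r} {lam lam' : Vec ℕ r} {i} → RITMoveOnRow lam i lam' →
  Σ ℕ λ x → ShortensRow lam i x × lam' ≡ lam [ i ]≔ x
ritMove⇒shortensRow (zero , () , _)
ritMove⇒shortensRow (suc x , _ , _ , x<λᵢ , later , lam'≡) =
  x , (x<λᵢ , λ j i<j → ≤-pred (later j i<j)) , lam'≡

shortensRow⇒ritMove : ∀ {r} (lam : Vec ℕ r) {i x} → IsPartition lam → ShortensRow lam i x →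
  RITMoveOnRow lam i (lam [ i ]≔ x)
shortensRow⇒ritMove lam {i} {x} part (x<λᵢ , later) =
  suc x , s≤s z≤n , ≤-trans x<λᵢ (isPartition-lookup≤first lam part i) , x<λᵢ ,
  (λ j i<j → s≤s (later j i<j)) , refl

core-[]≔-oddRow : ∀ {r} (lam : Vec ℕ r) (i : Fin r) (x : ℕ) → OddRow i → core (lam [ i ]≔ x) ≡ core lam
core-[]≔-oddRow (_ ∷ [])    zero          _ _   = refl
core-[]≔-oddRow (_ ∷ _ ∷ _) zero          _ _   = refl
core-[]≔-oddRow (_ ∷ _ ∷ _) (suc zero)    _ ()
core-[]≔-oddRow (_ ∷ b ∷ t) (suc (suc i)) x odd = cong (λ v → b ∷ b ∷ v) (core-[]≔-oddRow t i x odd)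

nimMove-head : ∀ {n} {c q} {u : Vec ℕ n} → q < c → NimMove (c ∷ u) (q ∷ u)
nimMove-head q<c = zero , q<c , λ { zero 0≢0 → contradiction refl 0≢0 ; (suc _) _ → refl }

nimMove-∷ : ∀ {n} {c} {u v : Vec ℕ n} → NimMove u v → NimMove (c ∷ u) (c ∷ v)
nimMove-∷ (m , lt , same) = suc m , lt , λ { zero _ → refl ; (suc j) j≢m → same j (j≢m ∘ cong suc) }

nimMove-∷⁻ : ∀ {n} {c q} {u v : Vec ℕ n} → NimMove (c ∷ u) (q ∷ v) →
  (q < c × v ≡ u) ⊎ (q ≡ c × NimMove u v)
nimMove-∷⁻ (zero , q<c , same) = inj₁ (q<c , lookup-extensionality λ j → same (suc j) λ ())
nimMove-∷⁻ (suc m , lt , same) =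
  inj₂ (same zero (λ ()) , m , lt , λ j j≢m → same (suc j) (j≢m ∘ suc-injective))

shortensOddRow⇒nimMove : ∀ {r} (lam : Vec ℕ r) (i : Fin r) {x} → OddRow i → ShortensRow lam i x →
  NimMove (rem lam) (rem (lam [ i ]≔ x))
shortensOddRow⇒nimMove (_ ∷ [])    zero          _   (x<a , _)     = nimMove-head x<a
shortensOddRow⇒nimMove (_ ∷ _ ∷ _) zero          _   (x<a , later) =
  nimMove-head (∸-monoˡ-< x<a (later (suc zero) (s≤s z≤n)))
shortensOddRow⇒nimMove (_ ∷ _ ∷ _) (suc zero)    ()
shortensOddRow⇒nimMove (_ ∷ _ ∷ t) (suc (suc i)) odd shortens =
  nimMove-∷ (shortensOddRow⇒nimMove t i odd (shortensRow-tail (shortensRow-tail shortens)))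

nimMove⇒shortensOddRow : ∀ {r} (lam : Vec ℕ r) → IsPartition lam → (p : Vec ℕ (remLen r)) →
  NimMove (rem lam) p →
  Σ (Fin r) λ i → Σ ℕ λ x → OddRow i × ShortensRow lam i x × rem (lam [ i ]≔ x) ≡ p
nimMove⇒shortensOddRow [] _ [] (() , _)
nimMove⇒shortensOddRow (a ∷ []) _ (q ∷ []) move with nimMove-∷⁻ move
... | inj₁ (q<a , _)     = zero , q , refl , (q<a , λ { zero () }) , refl
... | inj₂ (_ , () , _)
nimMove⇒shortensOddRow (a ∷ b ∷ t) part (q ∷ p) move with nimMove-∷⁻ move
... | inj₁ (q<a∸b , p≡rem) =
  zero , q + b , refl , (m≤o∸n⇒m+n≤o (suc q) b≤a q<a∸b , later) , cong₂ _∷_ (m+n∸n≡m q b) (sym p≡rem)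
  where
  b≤a : b ≤ a
  b≤a = part zero (suc zero) z≤n
  later : (j : Fin _) → 0 < toℕ j → lookup (a ∷ b ∷ t) j ≤ q + b
  later (suc j) _ = ≤-trans (part (suc zero) (suc j) (s≤s z≤n)) (m≤n+m b q)
... | inj₂ (refl , move') with nimMove⇒shortensOddRow t (isPartition-tail (isPartition-tail part)) p move'
...   | i , x , odd , shortens , rem≡p =
  suc (suc i) , x , odd , shortensRow-∷ (shortensRow-∷ shortens) , cong (a ∸ b ∷_) rem≡p

oddRowMove⇒nimMove : ∀ {r} (lam : Vec ℕ r) (i : Fin r) (lam' : Vec ℕ r) → OddRow i →
  RITMoveOnRow lam i lam' → (core lam' ≡ core lam) × NimMove (rem lam) (rem lam')
oddRowMove⇒nimMove lam i lam' odd move with ritMove⇒shortensRow move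
... | x , shortens , refl = core-[]≔-oddRow lam i x odd , shortensOddRow⇒nimMove lam i odd shortens

nimMove⇒oddRowMove : ∀ {r} (lam : Vec ℕ r) → IsPartition lam → (p : Vec ℕ (remLen r)) →
  NimMove (rem lam) p →
  Σ (Fin r) λ i → Σ (Vec ℕ r) λ lam' →
    OddRow i × RITMoveOnRow lam i lam' × (core lam' ≡ core lam) × (rem lam' ≡ p)
nimMove⇒oddRowMove lam part p move with nimMove⇒shortensOddRow lam part p move
... | i , x , odd , shortens , rem≡p =
  i , lam [ i ]≔ x , odd , shortensRow⇒ritMove lam part shortens , core-[]≔-oddRow lam i x odd , rem≡p

lemma3p1 : (r : ℕ) (lam : Vec ℕ r) → IsPartition lam → lam ≢ replicate r 0 →
    (((i : Fin r) (lam' : Vec ℕ r) → OddRow i → RITMoveOnRow lam i lam' →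
        (core lam' ≡ core lam) × NimMove (rem lam) (rem lam'))
    × ((p : Vec ℕ (remLen r)) → NimMove (rem lam) p →
        Σ (Fin r) λ i → Σ (Vec ℕ r) λ lam' →
          OddRow i × RITMoveOnRow lam i lam' × (core lam' ≡ core lam) × (rem lam' ≡ p)))
lemma3p1 r lam part _ = oddRowMove⇒nimMove lam , nimMove⇒oddRowMove lam part
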